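{- Let $x>1$ be irrational with OCF expansion $[(a_1,e_1),(a_2,e_2),\dots]$ and convergents $p_k/q_k$. For all $n\ge1$: if $e_n=+1$ then $\frac{p_n}{p_{n-1}}\ge g$ and $\frac{q_n}{q_{n-1}}\ge g$; if $e_n=-1$ then $\frac{p_n}{p_{n-1}}\ge G+1$ and $\frac{q_n}{q_{n-1}}\ge G+1$.
   Context: $G=\frac{\sqrt5+1}{2}$, $g=\frac{\sqrt5-1}{2}$. Every irrational $x>1$ has a unique odd continued fraction (OCF) expansion $x=a_1+\cfrac{e_1}{a_2+\cfrac{e_2}{a_3+\ddots}}=:[(a_1,e_1),(a_2,e_2),\dots]$ with $a_i$ odd positive integers, $e_i\in\{\pm1\}$, $a_i+e_i\ge2$. Convergents: $p_0=1$, $p_1=a_1$, $p_k=a_kp_{k-1}+e_{k-1}p_{k-2}$; $q_0=0$, $q_1=1$, $q_k=a_kq_{k-1}+e_{k-1}q_{k-2}$ (with $e_0=1$); a ratio with zero denominator is interpreted as $+\infty$. -}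

module Defs where

open import Data.Nat using (ℕ; zero; suc; _≤_)
import Data.Nat as ℕ
open import Data.Integer using (ℤ; +_; -[1+_]; _+_; _*_; -_; _-_)
import Data.Integer as ℤ
open import Data.Product using (Σ; ∃; _×_)
open import Data.Sum using (_⊎_)
open import Data.Unit using (⊤)
open import Relation.Binary.PropositionalEquality using (_≡_)

Odd : ℕ → Set
Odd n = ∃ λ k → n ≡ suc (2 ℕ.* k)

-- Admissible OCF digit data, indexed from 1 (index 0 unused):
-- a_i odd positive, e_i ∈ {+1,-1}, a_i + e_i ≥ 2.
record IsOCFDigits (a : ℕ → ℕ) (e : ℕ → ℤ) : Set where
  field
    a-odd : ∀ i → 1 ≤ i → Odd (a i)
    a-pos : ∀ i → 1 ≤ i → 1 ≤ a i
    e-sign : ∀ i → 1 ≤ i → (e i ≡ ℤ.+ 1) ⊎ (e i ≡ ℤ.- (ℤ.+ 1))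
    a+e≥2 : ∀ i → 1 ≤ i → ℤ.+ 2 ℤ.≤ ℤ.+ (a i) + e i

conv : ℤ → ℤ → (ℕ → ℕ) → (ℕ → ℤ) → ℕ → ℤ
conv u₀ u₁ a e zero = u₀
conv u₀ u₁ a e (suc zero) = u₁
conv u₀ u₁ a e (suc (suc k)) =
  ℤ.+ (a (suc (suc k))) * conv u₀ u₁ a e (suc k) + e (suc k) * conv u₀ u₁ a e k

p : (ℕ → ℕ) → (ℕ → ℤ) → ℕ → ℤ
p a e = conv (ℤ.+ 1) (ℤ.+ (a 1)) a e

q : (ℕ → ℕ) → (ℕ → ℤ) → ℕ → ℤ
q a e = conv (ℤ.+ 0) (ℤ.+ 1) a e

-- For an integer A and natural m: the real inequality  A ≥ √5 · m,
-- written out exactly (both sides nonnegative, compare squares).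
GeSqrt5 : ℤ → ℕ → Set
GeSqrt5 A m = (ℤ.+ 0 ℤ.≤ A) × (ℤ.+ 5 * (ℤ.+ m * ℤ.+ m) ℤ.≤ A * A)

-- RatioGe c r s : the real inequality  r / s ≥ (c + √5) / 2,
-- with the convention that r / 0 = +∞ (so the inequality holds).
-- For s > 0 this is 2r - c s ≥ √5 s; for s < 0 use r/s = (-r)/(-s).
RatioGe : ℤ → ℤ → ℤ → Set
RatioGe c r (+ zero) = ⊤
RatioGe c r (+ suc m) = GeSqrt5 (ℤ.+ 2 * r - c * ℤ.+ suc m) (suc m)
RatioGe c r -[1+ m ] = GeSqrt5 (ℤ.+ 2 * (- r) - c * ℤ.+ suc m) (suc m)

-- g = (√5 - 1)/2 = (c + √5)/2 with c = -1
RatioGe-g : ℤ → ℤ → Set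
RatioGe-g = RatioGe (ℤ.- ℤ.+ 1)

-- G + 1 = (√5 + 3)/2 = (c + √5)/2 with c = 3
RatioGe-G+1 : ℤ → ℤ → Set
RatioGe-G+1 = RatioGe (ℤ.+ 3)

-- Write r_n = u_n / u_{n-1} for either sequence of convergents, so that
-- r_{n+1} = a_{n+1} + e_n / r_n.  By induction r_n ≥ g when e_n = +1 and
-- r_n ≥ G + 1 when e_n = -1 (then a_n ≥ 3): if e_n = +1 the next ratio is at
-- least a_{n+1} ≥ 1, and if e_n = -1 it is at least a_{n+1} - 1/(G+1) =
-- a_{n+1} - g², which is ≥ 1 - g² = g, and ≥ 3 - g² = G + 1 when a_{n+1} ≥ 3.
-- Since G + 1 = 2 + g, both bounds reduce to X/Y ≥ g, which for integers
-- X ≥ 1, Y ≥ 0 is the polynomial inequality X² + XY - Y² ≥ 0; each induction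
-- step is then an explicit polynomial identity with nonnegative right-hand side.
module Submission where

open import Defs
open import Data.Nat using (ℕ; _≤_; _∸_; suc; s≤s; z≤n)
open import Data.Integer using (ℤ; +_; -_; -[1+_]; _+_; _*_; _-_; +≤+)
import Data.Integer as ℤ
open import Data.Integer.Properties using (+-mono-≤; 0≤i-j⇒j≤i; ≤-trans; pos-*)
open import Data.Integer.Tactic.RingSolver using (solve-∀)
open import Data.Product using (_×_; _,_; proj₁; proj₂)
open import Data.Sum using (_⊎_; inj₁; inj₂)
open import Data.Unit using (tt)
open import Relation.Binary.PropositionalEquality using (_≡_; refl; sym; subst)

infix 4 0≤_
0≤_ : ℤ → Set
0≤ x = + 0 ℤ.≤ x

infixl 6 _⊕_
infixl 7 _⊗_

_⊕_ : ∀ {x y} → 0≤ x → 0≤ y → 0≤ (x + y)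
_⊕_ = +-mono-≤

_⊗_ : ∀ {x y} → 0≤ x → 0≤ y → 0≤ (x * y)
+≤+ {n = m} _ ⊗ +≤+ {n = n} _ = subst 0≤_ (pos-* m n) (+≤+ z≤n)

0≤+ : ∀ n → 0≤ (+ n)
0≤+ n = +≤+ z≤n

infix 1 _by_
_by_ : ∀ {x y} → 0≤ y → x ≡ y → 0≤ x
0≤y by x≡y = subst 0≤_ (sym x≡y) 0≤y

Ratio≥g : ℤ → ℤ → Set
Ratio≥g X Y = 0≤ (X - + 1) × 0≤ Y × 0≤ (X * X + X * Y - Y * Y)

Ratio≥G+1 : ℤ → ℤ → Set
Ratio≥G+1 X Y = Ratio≥g (X - + 2 * Y) Y

ratio≥g⇒0≤ : ∀ {X Y} → Ratio≥g X Y → 0≤ X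
ratio≥g⇒0≤ (0≤X-1 , _) = ≤-trans (0≤+ 1) (0≤i-j⇒j≤i 0≤X-1)

ratio≥g-step⁺ : ∀ D X Y → 0≤ D → Ratio≥g X Y → Ratio≥g ((+ 1 + D) * X + + 1 * Y) X
ratio≥g-step⁺ D X Y 0≤D r@(0≤X-1 , 0≤Y , _) =
  (0≤X-1 ⊕ 0≤DX+Y by linear D X Y) , 0≤X , (0≤X ⊗ 0≤X ⊕ 0≤+ 3 ⊗ 0≤X ⊗ 0≤DX+Y ⊕ 0≤DX+Y ⊗ 0≤DX+Y by quadratic D X Y)
  where
  0≤X : 0≤ X
  0≤X = ratio≥g⇒0≤ r
  0≤DX+Y : 0≤ (D * X + Y)
  0≤DX+Y = 0≤D ⊗ 0≤X ⊕ 0≤Y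
  linear : ∀ D X Y → (+ 1 + D) * X + + 1 * Y - + 1 ≡ X - + 1 + (D * X + Y)
  linear = solve-∀
  quadratic : ∀ D X Y → let X′ = (+ 1 + D) * X + + 1 * Y in
    X′ * X′ + X′ * X - X * X ≡ X * X + + 3 * X * (D * X + Y) + (D * X + Y) * (D * X + Y)
  quadratic = solve-∀

ratio≥g-step⁻ : ∀ D X Y → 0≤ D → Ratio≥G+1 X Y → Ratio≥g ((+ 1 + D) * X + - + 1 * Y) X
ratio≥g-step⁻ D X Y 0≤D (0≤Z-1 , 0≤Y , 0≤QZY) =
  (0≤D ⊗ 0≤X ⊕ 0≤Z-1 ⊕ 0≤Y by linear D X Y) , 0≤X ,
  (0≤D ⊗ 0≤D ⊗ (0≤X ⊗ 0≤X) ⊕ 0≤+ 2 ⊗ (0≤D ⊗ 0≤X ⊗ 0≤X-Y) ⊕ 0≤D ⊗ (0≤X ⊗ 0≤X) ⊕ 0≤QZY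
    by quadratic D X Y)
  where
  difference : ∀ X Y → X - Y ≡ X - + 2 * Y - + 1 + Y + + 1
  difference = solve-∀
  undifference : ∀ X Y → X ≡ X - Y + Y
  undifference = solve-∀
  0≤X-Y : 0≤ (X - Y)
  0≤X-Y = 0≤Z-1 ⊕ 0≤Y ⊕ 0≤+ 1 by difference X Y
  0≤X : 0≤ X
  0≤X = 0≤X-Y ⊕ 0≤Y by undifference X Y
  linear : ∀ D X Y → (+ 1 + D) * X + - + 1 * Y - + 1 ≡ D * X + (X - + 2 * Y - + 1) + Y
  linear = solve-∀
  quadratic : ∀ D X Y → let X′ = (+ 1 + D) * X + - + 1 * Y ; Z = X - + 2 * Y in
    X′ * X′ + X′ * X - X * X ≡ D * D * (X * X) + + 2 * (D * X * (X - Y)) + D * (X * X) + (Z * Z + Z * Y - Y * Y)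
  quadratic = solve-∀

Bound : ℤ → ℤ → ℤ → Set
Bound s X Y = (s ≡ + 1 → Ratio≥g X Y) × (s ≡ - + 1 → Ratio≥G+1 X Y)

ratio≥g-next : ∀ {s} a X Y → 1 ≤ a → s ≡ + 1 ⊎ s ≡ - + 1 → Bound s X Y →
  Ratio≥g (+ a * X + s * Y) X
ratio≥g-next (suc n) X Y _ (inj₁ refl) b = ratio≥g-step⁺ (+ n) X Y (0≤+ n) (proj₁ b refl)
ratio≥g-next (suc n) X Y _ (inj₂ refl) b = ratio≥g-step⁻ (+ n) X Y (0≤+ n) (proj₂ b refl)

ratio≥G+1-next : ∀ {s} a X Y → 3 ≤ a → s ≡ + 1 ⊎ s ≡ - + 1 → Bound s X Y →
  Ratio≥G+1 (+ a * X + s * Y) X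
ratio≥G+1-next {s} (suc (suc a-2)) X Y (s≤s (s≤s a-2≥1)) s± b =
  subst (λ W → Ratio≥g W X) (sym (shift (+ a-2) X (s * Y))) (ratio≥g-next a-2 X Y a-2≥1 s± b)
  where
  shift : ∀ A X V → (+ 2 + A) * X + V - + 2 * X ≡ A * X + V
  shift = solve-∀

digit≥3 : ∀ a → + 2 ℤ.≤ + a + - + 1 → 3 ≤ a
digit≥3 0 ()
digit≥3 1 (+≤+ ())
digit≥3 2 (+≤+ (s≤s ()))
digit≥3 (suc (suc (suc n))) _ = s≤s (s≤s (s≤s z≤n))

bound-next : ∀ {s t} a X Y → 1 ≤ a → + 2 ℤ.≤ + a + t → s ≡ + 1 ⊎ s ≡ - + 1 → Bound s X Y →
  Bound t (+ a * X + s * Y) X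
bound-next a X Y a≥1 a+t≥2 s± b =
  (λ _ → ratio≥g-next a X Y a≥1 s± b) ,
  (λ t≡-1 → ratio≥G+1-next a X Y (digit≥3 a (subst (λ t → + 2 ℤ.≤ + a + t) t≡-1 a+t≥2)) s± b)

conv-bound : ∀ {a e u₀ u₁} → IsOCFDigits a e → Bound (e 1) u₁ u₀ →
  ∀ m → Bound (e (suc m)) (conv u₀ u₁ a e (suc m)) (conv u₀ u₁ a e m)
conv-bound digits b 0 = b
conv-bound digits b (suc m) =
  bound-next _ _ _ (a-pos _ (s≤s z≤n)) (a+e≥2 _ (s≤s z≤n)) (e-sign _ (s≤s z≤n)) (conv-bound digits b m)
  where open IsOCFDigits digits

bound-1-0 : ∀ s → Bound s (+ 1) (+ 0)
bound-1-0 _ = (λ _ → 0≤+ 0 , 0≤+ 0 , 0≤+ 1) , (λ _ → 0≤+ 0 , 0≤+ 0 , 0≤+ 1)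

-- p continues backwards to p₋₁ = 0, so its start is one step from (1, 0).
p-start : ∀ {a e} → IsOCFDigits a e → Bound (e 1) (p a e 1) (p a e 0)
p-start {a} {e} digits =
  subst (λ X → Bound (e 1) X (+ 1)) (unit (+ a 1))
    (bound-next (a 1) (+ 1) (+ 0) (a-pos 1 (s≤s z≤n)) (a+e≥2 1 (s≤s z≤n)) (inj₁ refl) (bound-1-0 (+ 1)))
  where
  open IsOCFDigits digits
  unit : ∀ A → A * + 1 + + 1 * + 0 ≡ A
  unit = solve-∀

ratio≥g⇒GeSqrt5 : ∀ X m → Ratio≥g X (+ m) → GeSqrt5 (+ 2 * X - - + 1 * + m) m
ratio≥g⇒GeSqrt5 X m r@(_ , 0≤Y , 0≤Q) =
  (0≤+ 2 ⊗ ratio≥g⇒0≤ {X} r ⊕ 0≤Y by linear X (+ m)) , 0≤i-j⇒j≤i (0≤+ 4 ⊗ 0≤Q by quadratic X (+ m))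
  where
  linear : ∀ X Y → + 2 * X - - + 1 * Y ≡ + 2 * X + Y
  linear = solve-∀
  quadratic : ∀ X Y → (+ 2 * X - - + 1 * Y) * (+ 2 * X - - + 1 * Y) - + 5 * (Y * Y) ≡ + 4 * (X * X + X * Y - Y * Y)
  quadratic = solve-∀

ratio≥g⇒RatioGe-g : ∀ X Y → Ratio≥g X Y → RatioGe-g X Y
ratio≥g⇒RatioGe-g X (+ 0) _ = tt
ratio≥g⇒RatioGe-g X (+ suc m) r = ratio≥g⇒GeSqrt5 X (suc m) r
ratio≥g⇒RatioGe-g X -[1+ m ] (_ , () , _)

ratio≥G+1⇒RatioGe-G+1 : ∀ X Y → Ratio≥G+1 X Y → RatioGe-G+1 X Y
ratio≥G+1⇒RatioGe-G+1 X (+ 0) _ = tt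
ratio≥G+1⇒RatioGe-G+1 X (+ suc m) r =
  subst (λ A → GeSqrt5 A (suc m)) (shift X (+ suc m)) (ratio≥g⇒GeSqrt5 (X - + 2 * + suc m) (suc m) r)
  where
  shift : ∀ X Y → + 2 * (X - + 2 * Y) - - + 1 * Y ≡ + 2 * X - + 3 * Y
  shift = solve-∀
ratio≥G+1⇒RatioGe-G+1 X -[1+ m ] (_ , () , _)

bound⇒RatioGe : ∀ {s X Y} → Bound s X Y → (s ≡ + 1 → RatioGe-g X Y) × (s ≡ - + 1 → RatioGe-G+1 X Y)
bound⇒RatioGe {X = X} {Y} (b⁺ , b⁻) =
  (λ s≡+1 → ratio≥g⇒RatioGe-g X Y (b⁺ s≡+1)) , (λ s≡-1 → ratio≥G+1⇒RatioGe-G+1 X Y (b⁻ s≡-1))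

lemma22 : (a : ℕ → ℕ) (e : ℕ → ℤ) → IsOCFDigits a e → (n : ℕ) → 1 ≤ n →
    (e n ≡ + 1 → RatioGe-g (p a e n) (p a e (n ∸ 1)) × RatioGe-g (q a e n) (q a e (n ∸ 1)))
    × (e n ≡ - (+ 1) → RatioGe-G+1 (p a e n) (p a e (n ∸ 1)) × RatioGe-G+1 (q a e n) (q a e (n ∸ 1)))
lemma22 a e digits (suc m) _ =
  let (p⁺ , p⁻) = bound⇒RatioGe (conv-bound digits (p-start digits) m)
      (q⁺ , q⁻) = bound⇒RatioGe (conv-bound digits (bound-1-0 (e 1)) m)
  in (λ eₙ≡+1 → p⁺ eₙ≡+1 , q⁺ eₙ≡+1) , (λ eₙ≡-1 → p⁻ eₙ≡-1 , q⁻ eₙ≡-1)
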